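{- Let $a,m,s,k$ be positive integers, let $r=1+2ams$, and set \[ D:=m\left(2r^k+m\left(s+ar^k\right)^2\right). \] Define $p_1,\dots,p_{2k}$ by $p_{2j+1}=ar^{j}$ and $p_{2j+2}=2amr^{k-1-j}$ for $0\le j\le k-1$ (so the sequence is $a,\,2amr^{k-1},\,ar,\,2amr^{k-2},\dots,ar^{k-1},\,2am$). Then $l(D)=4k+2$ and \[ \sqrt D=[m(s+ar^k);\overline{p_1,p_2,\dots,p_{2k},\,s+ar^k,\,p_{2k},\dots,p_2,p_1,\,2m(s+ar^k)}]. \]
   Context: For a positive non-square integer $D$, $l(D)$ denotes the length of the fundamental (shortest) period of the regular continued fraction expansion of $\sqrt D$. $[a_0;\overline{b_1,\dots,b_m}]$ denotes the regular continued fraction whose partial quotients after $a_0$ are the block $b_1,\dots,b_m$ repeated infinitely often. -}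

module Defs where

open import Data.Nat as N using (ℕ; zero; suc; _^_; _∸_; _<ᵇ_; _≡ᵇ_; _%_; _/_)
open import Data.Integer as Z using (ℤ; +_)
open import Data.Bool using (if_then_else_)
open import Data.Product using (_×_; _,_)
open import Data.Sum using (_⊎_)
open import Relation.Binary.PropositionalEquality using (_≡_)
open import Relation.Nullary using (¬_)

-- Exact arithmetic in Q(√D), D a natural number.
-- A pair (u , v) of integers stands for the real number u + v·√D.

NonNeg : ℕ → ℤ → ℤ → Set
NonNeg D u v =
    (Z.0ℤ Z.≤ u × Z.0ℤ Z.≤ v)
  ⊎ (Z.0ℤ Z.≤ u × v Z.< Z.0ℤ × v Z.* v Z.* + D Z.≤ u Z.* u)
  ⊎ (u Z.< Z.0ℤ × Z.0ℤ Z.≤ v × u Z.* u Z.≤ v Z.* v Z.* + D)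

Pos : ℕ → ℤ → ℤ → Set
Pos D u v =
    (Z.0ℤ Z.< u × Z.0ℤ Z.≤ v)
  ⊎ (Z.0ℤ Z.≤ u × Z.0ℤ Z.< v)
  ⊎ (Z.0ℤ Z.≤ u × v Z.< Z.0ℤ × v Z.* v Z.* + D Z.< u Z.* u)
  ⊎ (u Z.< Z.0ℤ × Z.0ℤ Z.≤ v × u Z.* u Z.< v Z.* v Z.* + D)

-- A triple (A , B , C) stands for the real number (A + B√D) / C  (C ≠ 0).
QI : Set
QI = ℤ × ℤ × ℤ

-- c = ⌊(A + B√D)/C⌋, i.e. C ≠ 0 and c ≤ (A + B√D)/C < c + 1.
-- (Multiplying through by C² > 0:  C(A - cC) + CB√D ≥ 0  and
--  C((c+1)C - A) - CB√D > 0.)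
IsFloor : ℕ → QI → ℤ → Set
IsFloor D (A , B , C) c =
    ¬ (C ≡ Z.0ℤ)
  × NonNeg D (C Z.* (A Z.- c Z.* C)) (C Z.* B)
  × Pos D (C Z.* ((c Z.+ Z.1ℤ) Z.* C Z.- A)) (Z.- (C Z.* B))

-- x ↦ 1 / (x - c):  with x - c = (A' + B√D)/C, A' = A - cC,
-- 1/(x - c) = C(A' - B√D)/(A'² - B²D).
recipStep : ℕ → QI → ℤ → QI
recipStep D (A , B , C) c =
  let A' = A Z.- c Z.* C in
  (C Z.* A' , Z.- (C Z.* B) , A' Z.* A' Z.- B Z.* B Z.* + D)

completeQ : ℕ → (ℕ → ℤ) → ℕ → QI
completeQ D a zero = (Z.0ℤ , Z.1ℤ , Z.1ℤ)
completeQ D a (suc n) = recipStep D (completeQ D a n) (a n)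

IsCFsqrt : ℕ → (ℕ → ℤ) → Set
IsCFsqrt D a = ∀ n → IsFloor D (completeQ D a n) (a n)

IsPeriod : (ℕ → ℤ) → ℕ → Set
IsPeriod a p = ∀ n → 1 N.≤ n → a (n N.+ p) ≡ a n

FundamentalPeriod : (ℕ → ℤ) → ℕ → Set
FundamentalPeriod a l =
  0 N.< l × IsPeriod a l × (∀ p → 0 N.< p → IsPeriod a p → l N.≤ p)

-- 0-indexed p-sequence: pIdx i = p_{i+1}, for i < 2k:
-- p_{2j+1} = a r^j, p_{2j+2} = 2 a m r^{k-1-j}
pIdx : (a m r k : ℕ) → ℕ → ℕ
pIdx a m r k i =
  if i % 2 ≡ᵇ 0 then a N.* r ^ (i / 2)
  else 2 N.* a N.* m N.* r ^ (k ∸ 1 ∸ i / 2)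

block : (a m s k r : ℕ) → ℕ → ℕ
block a m s k r i =
  if i <ᵇ 2 N.* k then pIdx a m r k i
  else if i ≡ᵇ 2 N.* k then s N.+ a N.* r ^ k
  else if i <ᵇ 4 N.* k N.+ 1 then pIdx a m r k (4 N.* k ∸ i)
  else 2 N.* m N.* (s N.+ a N.* r ^ k)

cfPattern : (a m s k : ℕ) → ℕ → ℤ
cfPattern a m s k zero =
  let r = 1 N.+ 2 N.* a N.* m N.* s in + (m N.* (s N.+ a N.* r ^ k))
cfPattern a m s k (suc n) =
  let r = 1 N.+ 2 N.* a N.* m N.* s in + block a m s k r (n % (2 N.+ 4 N.* k))

-- Write the n-th complete quotient of √D as (Pₙ + √D)/Qₙ. Here D = a₀² + 2m r^k with
-- a₀ = m(s + a r^k) = ⌊√D⌋, and along the claimed expansion the numerators alternate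
-- between a₀ and a₀ − 2ms while the denominators run through
--   1, 2m r^k, r, 2m r^(k-1), r², …, r^k, 2m, r^k, …, r, 2m r^k, 1.
-- Each step  Pₙ₊₁ = cₙQₙ − Pₙ,  QₙQₙ₊₁ = D − Pₙ₊₁²,  Pₙ₊₁ ≤ a₀ < Pₙ₊₁ + Qₙ  then reduces to
-- an identity between powers of r, and since such triples pin down the complete quotients
-- exactly, the expansion is the claimed one. The period is exactly 4k + 2 because the last
-- partial quotient of the block, 2a₀, exceeds every other one.

module Submission where

open import Defs
open import Data.Bool.Base using (true; false; T; if_then_else_)
open import Data.Bool.Properties using (T-≡)
open import Data.Integer.Base as ℤ using (ℤ)
open import Data.Integer.Properties using (+-injective)
open import Data.Nat.Base as ℕ using (ℕ; zero; suc; z≤n)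
import Data.Nat.Properties as ℕ
import Data.Nat.Tactic.RingSolver as ℕ-Solver
open import Data.Nat.DivMod
  using (m*n%n≡0; m*n/n≡m; [m+kn]%n≡m%n; +-distrib-/; m%n<n; %-distribˡ-+; m<n⇒m%n≡m; n%n≡0; [m+n]%n≡m%n)
open import Data.Product using (∃; _×_; _,_; proj₁; proj₂)
open import Data.Sum using (_⊎_; inj₁; inj₂; [_,_]′)
open import Function using (_∘_)
open import Function.Bundles using (_⇔_; mk⇔; Equivalence)
open import Relation.Binary.Definitions using (tri<; tri≈; tri>)
open import Relation.Binary.PropositionalEquality
open import Relation.Nullary using (¬_; contradiction; yes; no)

completeQ-cong : ∀ D {f g : ℕ → ℤ} → f ≗ g → completeQ D f ≗ completeQ D g
completeQ-cong D f≗g zero = refl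
completeQ-cong D f≗g (suc n) = cong₂ (recipStep D) (completeQ-cong D f≗g n) (f≗g n)

IsCFsqrt-cong : ∀ {D f g} → f ≗ g → IsCFsqrt D f → IsCFsqrt D g
IsCFsqrt-cong {D} f≗g cf n = subst₂ (IsFloor D) (completeQ-cong D f≗g n) (f≗g n) (cf n)

IsPeriod-cong : ∀ {f g p} → f ≗ g → IsPeriod f p → IsPeriod g p
IsPeriod-cong {f} {g} {p} f≗g per n 1≤n = begin
  g (n ℕ.+ p)  ≡⟨ sym (f≗g _) ⟩
  f (n ℕ.+ p)  ≡⟨ per n 1≤n ⟩
  f n          ≡⟨ f≗g n ⟩
  g n          ∎
  where open ≡-Reasoning

FundamentalPeriod-cong : ∀ {f g l} → f ≗ g → FundamentalPeriod f l → FundamentalPeriod g l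
FundamentalPeriod-cong f≗g (l>0 , per , least) =
  l>0 , IsPeriod-cong f≗g per , λ p p>0 → least p p>0 ∘ IsPeriod-cong (sym ∘ f≗g)

[m*n]*[m*n]≡m*m*[n*n] : ∀ m n → m ℕ.* n ℕ.* (m ℕ.* n) ≡ m ℕ.* m ℕ.* (n ℕ.* n)
[m*n]*[m*n]≡m*m*[n*n] = ℕ-Solver.solve-∀

module SqrtExpansion (D a₀ : ℕ) (a₀²≤D : a₀ ℕ.* a₀ ℕ.≤ D) (D<[1+a₀]² : D ℕ.< suc a₀ ℕ.* suc a₀) where

  ≤a₀⇒square≤D : ∀ {x} → x ℕ.≤ a₀ → x ℕ.* x ℕ.≤ D
  ≤a₀⇒square≤D x≤a₀ = ℕ.≤-trans (ℕ.*-mono-≤ x≤a₀ x≤a₀) a₀²≤D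

  square≤D⇒≤a₀ : ∀ {x} → x ℕ.* x ℕ.≤ D → x ℕ.≤ a₀
  square≤D⇒≤a₀ x²≤D = ℕ.≮⇒≥ λ a₀<x → ℕ.<⇒≱ D<[1+a₀]² (ℕ.≤-trans (ℕ.*-mono-≤ a₀<x a₀<x) x²≤D)

  a₀<⇒D<square : ∀ {y} → a₀ ℕ.< y → D ℕ.< y ℕ.* y
  a₀<⇒D<square a₀<y = ℕ.<-≤-trans D<[1+a₀]² (ℕ.*-mono-≤ a₀<y a₀<y)

  D<square⇒a₀< : ∀ {y} → D ℕ.< y ℕ.* y → a₀ ℕ.< y
  D<square⇒a₀< D<y² = ℕ.≰⇒> λ y≤a₀ → ℕ.<⇒≱ D<y² (≤a₀⇒square≤D y≤a₀)

  ≤a₀⇒scaledSquare≤D : ∀ W {x} → x ℕ.≤ a₀ → W ℕ.* x ℕ.* (W ℕ.* x) ℕ.≤ W ℕ.* W ℕ.* D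
  ≤a₀⇒scaledSquare≤D W {x} x≤a₀ =
    subst (ℕ._≤ W ℕ.* W ℕ.* D) (sym ([m*n]*[m*n]≡m*m*[n*n] W x))
      (ℕ.*-monoʳ-≤ (W ℕ.* W) (≤a₀⇒square≤D x≤a₀))

  scaledSquare≤D⇒≤a₀ : ∀ W {x} .{{_ : ℕ.NonZero W}} → W ℕ.* x ℕ.* (W ℕ.* x) ℕ.≤ W ℕ.* W ℕ.* D → x ℕ.≤ a₀
  scaledSquare≤D⇒≤a₀ W {x} ≤ = square≤D⇒≤a₀
    (ℕ.*-cancelˡ-≤ (W ℕ.* W) {{ℕ.m*n≢0 W W}} (subst (ℕ._≤ W ℕ.* W ℕ.* D) ([m*n]*[m*n]≡m*m*[n*n] W x) ≤))

  a₀<⇒D<scaledSquare : ∀ W {y} .{{_ : ℕ.NonZero W}} → a₀ ℕ.< y → W ℕ.* W ℕ.* D ℕ.< W ℕ.* y ℕ.* (W ℕ.* y)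
  a₀<⇒D<scaledSquare W {y} a₀<y =
    subst (W ℕ.* W ℕ.* D ℕ.<_) (sym ([m*n]*[m*n]≡m*m*[n*n] W y))
      (ℕ.*-monoʳ-< (W ℕ.* W) {{ℕ.m*n≢0 W W}} (a₀<⇒D<square a₀<y))

  D<scaledSquare⇒a₀< : ∀ W {y} → W ℕ.* W ℕ.* D ℕ.< W ℕ.* y ℕ.* (W ℕ.* y) → a₀ ℕ.< y
  D<scaledSquare⇒a₀< W {y} < = D<square⇒a₀<
    (ℕ.*-cancelˡ-< (W ℕ.* W) D (y ℕ.* y) (subst (W ℕ.* W ℕ.* D ℕ.<_) ([m*n]*[m*n]≡m*m*[n*n] W y) <))

  -- (P + √D)/Q has floor c, and the next complete quotient is (P′ + √D)/Q′.
  record Step (P Q c P′ Q′ : ℕ) : Set where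
    field
      quotient : c ℕ.* Q ≡ P ℕ.+ P′
      norm     : Q ℕ.* Q′ ℕ.+ P′ ℕ.* P′ ≡ D
      Q>0      : 0 ℕ.< Q
      P′≤a₀    : P′ ℕ.≤ a₀
      a₀<P′+Q  : a₀ ℕ.< P′ ℕ.+ Q

  open Step

  open import Data.Integer.Base hiding (suc)
  open import Data.Integer.Properties
  open import Data.Integer.Tactic.RingSolver using (solve-∀)

  scaledD : ∀ W → +[1+ W ] * +[1+ W ] * + D ≡ + (suc W ℕ.* suc W ℕ.* D)
  scaledD W = sym (pos-* (suc W ℕ.* suc W) D)

  scaledSquare : ∀ W Y → +[1+ W ] * + Y * (+[1+ W ] * + Y) ≡ + (suc W ℕ.* Y ℕ.* (suc W ℕ.* Y))
  scaledSquare W Y = sym (trans (pos-* (suc W ℕ.* Y) _) (cong₂ _*_ (pos-* (suc W) Y) (pos-* (suc W) Y)))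

  ≤a₀⇒nonNeg : ∀ {w} z → 0ℤ < w → - z ≤ + a₀ → NonNeg D (w * z) w
  ≤a₀⇒nonNeg {+0} _ (+<+ ()) _
  ≤a₀⇒nonNeg {+[1+ W ]} (+ n) _ _ = inj₁ (subst (0ℤ ≤_) (pos-* (suc W) n) (+≤+ z≤n) , +≤+ z≤n)
  ≤a₀⇒nonNeg {+[1+ W ]} -[1+ n ] _ (+≤+ 1+n≤a₀) =
    inj₂ (inj₂ (-<+ , +≤+ z≤n , subst (_ ≤_) (sym (scaledD W)) (+≤+ (≤a₀⇒scaledSquare≤D (suc W) 1+n≤a₀))))

  nonNeg⇒≤a₀ : ∀ {w} z → 0ℤ < w → NonNeg D (w * z) w → - z ≤ + a₀
  nonNeg⇒≤a₀ {+0} _ (+<+ ()) _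
  nonNeg⇒≤a₀ (+ n) _ _ = neg-≤-pos
  nonNeg⇒≤a₀ {+[1+ W ]} -[1+ n ] _ (inj₁ (() , _))
  nonNeg⇒≤a₀ {+[1+ W ]} -[1+ n ] _ (inj₂ (inj₁ (_ , +<+ () , _)))
  nonNeg⇒≤a₀ {+[1+ W ]} -[1+ n ] _ (inj₂ (inj₂ (_ , _ , square≤))) =
    +≤+ (scaledSquare≤D⇒≤a₀ (suc W) (drop‿+≤+ (subst (_ ≤_) (scaledD W) square≤)))

  a₀<⇒pos : ∀ {w} y → 0ℤ < w → + a₀ < y → Pos D (w * y) (- w)
  a₀<⇒pos {+0} _ (+<+ ()) _
  a₀<⇒pos {+[1+ W ]} (+ Y) _ (+<+ a₀<Y) =
    inj₂ (inj₂ (inj₁ (subst (0ℤ ≤_) (pos-* (suc W) Y) (+≤+ z≤n) , -<+ ,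
      subst₂ _<_ (sym (scaledD W)) (sym (scaledSquare W Y)) (+<+ (a₀<⇒D<scaledSquare (suc W) a₀<Y)))))

  pos⇒a₀< : ∀ {w} y → 0ℤ < w → Pos D (w * y) (- w) → + a₀ < y
  pos⇒a₀< {+0} _ (+<+ ()) _
  pos⇒a₀< {+[1+ W ]} _ _ (inj₁ (_ , ()))
  pos⇒a₀< {+[1+ W ]} _ _ (inj₂ (inj₁ (_ , ())))
  pos⇒a₀< {+[1+ W ]} _ _ (inj₂ (inj₂ (inj₂ (_ , () , _))))
  pos⇒a₀< {+[1+ W ]} -[1+ n ] _ (inj₂ (inj₂ (inj₁ (() , _ , _))))
  pos⇒a₀< {+[1+ W ]} (+ Y) _ (inj₂ (inj₂ (inj₁ (_ , _ , square>)))) =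
    +<+ (D<scaledSquare⇒a₀< (suc W) (drop‿+<+ (subst₂ _<_ (scaledD W) (scaledSquare W Y) square>)))

  -- c = ⌊(P + √D)/Q⌋, for Q > 0.
  FloorBounds : ℕ → ℕ → ℤ → Set
  FloorBounds P Q c = c * + Q - + P ≤ + a₀ × + a₀ < (c + 1ℤ) * + Q - + P

  floorBound-mono : ∀ {P Q x y} → x < y → (x + 1ℤ) * + Q - + P ≤ y * + Q - + P
  floorBound-mono {P} {Q} {x} x<y =
    +-monoˡ-≤ (- + P) (*-monoʳ-≤-nonNeg (+ Q) (subst (_≤ _) (+-comm 1ℤ x) (i<j⇒suc[i]≤j x<y)))

  floorBounds-unique : ∀ {P Q c c′} → FloorBounds P Q c → FloorBounds P Q c′ → c′ ≡ c
  floorBounds-unique {P} {Q} {c} {c′} (lower , upper) (lower′ , upper′) with <-cmp c′ c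
  ... | tri≈ _ c′≡c _ = c′≡c
  ... | tri< c′<c _ _ = contradiction (≤-trans (floorBound-mono {P} c′<c) lower) (<⇒≱ upper′)
  ... | tri> _ _ c<c′ = contradiction (≤-trans (floorBound-mono {P} c<c′) lower′) (<⇒≱ upper)

  l*l*Q>0 : ∀ {l Q} → l ≢ 0ℤ → 0 ℕ.< Q → 0ℤ < l * l * + Q
  l*l*Q>0 {+0}       l≢0 _ = contradiction refl l≢0
  l*l*Q>0 {+[1+ _ ]} {suc _} _ _ = +<+ ℕ.z<s
  l*l*Q>0 { -[1+ _ ]} {suc _} _ _ = +<+ ℕ.z<s

  -- The triple (l P, l, l Q) represents (P + √D)/Q; both floor conditions get scaled by l² Q > 0.
  isFloor⇔floorBounds : ∀ {l P Q c} → l ≢ 0ℤ → 0 ℕ.< Q → IsFloor D (l * + P , l , l * + Q) c ⇔ FloorBounds P Q c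
  isFloor⇔floorBounds {l} {P} {Q} {c} l≢0 Q>0 = mk⇔
    (λ (_ , nonNeg , pos) →
      subst (_≤ + a₀) (neg-diff (+ P) c (+ Q))
        (nonNeg⇒≤a₀ _ w>0 (subst₂ (NonNeg D) (lower l (+ P) (+ Q) c) (scale l (+ Q)) nonNeg)) ,
      pos⇒a₀< _ w>0 (subst₂ (Pos D) (upper l (+ P) (+ Q) c) (cong -_ (scale l (+ Q))) pos))
    (λ (lower≤ , a₀<upper) →
      lQ≢0 ,
      subst₂ (NonNeg D) (sym (lower l (+ P) (+ Q) c)) (sym (scale l (+ Q)))
        (≤a₀⇒nonNeg _ w>0 (subst (_≤ + a₀) (sym (neg-diff (+ P) c (+ Q))) lower≤)) ,
      subst₂ (Pos D) (sym (upper l (+ P) (+ Q) c)) (cong -_ (sym (scale l (+ Q)))) (a₀<⇒pos _ w>0 a₀<upper))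
    where
    w>0 : 0ℤ < l * l * + Q
    w>0 = l*l*Q>0 l≢0 Q>0
    lQ≢0 : l * + Q ≢ 0ℤ
    lQ≢0 lQ≡0 = [ l≢0 , (λ Q≡0 → ℕ.<⇒≢ Q>0 (sym (+-injective Q≡0))) ]′ (i*j≡0⇒i≡0∨j≡0 l lQ≡0)
    neg-diff : ∀ P c Q → - (P - c * Q) ≡ c * Q - P
    neg-diff = solve-∀
    lower : ∀ l P Q c → (l * Q) * (l * P - c * (l * Q)) ≡ l * l * Q * (P - c * Q)
    lower = solve-∀
    upper : ∀ l P Q c → (l * Q) * ((c + 1ℤ) * (l * Q) - l * P) ≡ l * l * Q * ((c + 1ℤ) * Q - P)
    upper = solve-∀
    scale : ∀ l Q → (l * Q) * l ≡ l * l * Q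
    scale = solve-∀

  module _ {P Q c P′ Q′} (step : Step P Q c P′ Q′) where

    next-numerator : + c * + Q - + P ≡ + P′
    next-numerator = begin
      + c * + Q - + P        ≡⟨ cong (_- + P) (sym (pos-* c Q)) ⟩
      + (c ℕ.* Q) - + P      ≡⟨ cong (λ x → + x - + P) (quotient step) ⟩
      + (P ℕ.+ P′) - + P     ≡⟨ cong (_- + P) (pos-+ P P′) ⟩
      + P + + P′ - + P       ≡⟨ x+y-x≡y (+ P) (+ P′) ⟩
      + P′                   ∎
      where
      open ≡-Reasoning
      x+y-x≡y : ∀ x y → x + y - x ≡ y
      x+y-x≡y = solve-∀

    next-norm : + P′ * + P′ - + D ≡ - (+ Q * + Q′)
    next-norm = begin
      + P′ * + P′ - + D                      ≡⟨ cong (λ x → + P′ * + P′ - x) (sym D≡) ⟩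
      + P′ * + P′ - (+ Q * + Q′ + + P′ * + P′) ≡⟨ y-[x+y]≡-x (+ Q * + Q′) (+ P′ * + P′) ⟩
      - (+ Q * + Q′)                         ∎
      where
      open ≡-Reasoning
      y-[x+y]≡-x : ∀ x y → y - (x + y) ≡ - x
      y-[x+y]≡-x = solve-∀
      D≡ : + Q * + Q′ + + P′ * + P′ ≡ + D
      D≡ = begin
        + Q * + Q′ + + P′ * + P′     ≡⟨ cong₂ _+_ (sym (pos-* Q Q′)) (sym (pos-* P′ P′)) ⟩
        + (Q ℕ.* Q′) + + (P′ ℕ.* P′)  ≡⟨ sym (pos-+ (Q ℕ.* Q′) _) ⟩
        + (Q ℕ.* Q′ ℕ.+ P′ ℕ.* P′)    ≡⟨ cong +_ (norm step) ⟩
        + D                          ∎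

    step⇒floorBounds : FloorBounds P Q (+ c)
    step⇒floorBounds =
      subst (_≤ + a₀) (sym next-numerator) (+≤+ (P′≤a₀ step)) ,
      subst (+ a₀ <_) upper≡ (+<+ (a₀<P′+Q step))
      where
      upper≡ : + (P′ ℕ.+ Q) ≡ (+ c + 1ℤ) * + Q - + P
      upper≡ = begin
        + (P′ ℕ.+ Q)             ≡⟨ pos-+ P′ Q ⟩
        + P′ + + Q               ≡⟨ cong (_+ + Q) (sym next-numerator) ⟩
        + c * + Q - + P + + Q    ≡⟨ shift (+ c) (+ Q) (+ P) ⟩
        (+ c + 1ℤ) * + Q - + P   ∎
        where
        open ≡-Reasoning
        shift : ∀ c Q P → c * Q - P + Q ≡ (c + 1ℤ) * Q - P
        shift = solve-∀

    recipStep-proportional : ∀ l → recipStep D (l * + P , l , l * + Q) (+ c)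
      ≡ (- (l * l * + Q) * + P′ , - (l * l * + Q) , - (l * l * + Q) * + Q′)
    recipStep-proportional l = cong₂ _,_ numerator (cong₂ _,_ (scale l (+ Q)) denominator)
      where
      open ≡-Reasoning
      scale : ∀ l Q → - (l * Q * l) ≡ - (l * l * Q)
      scale = solve-∀
      numerator-expand : ∀ l Q P c → l * Q * (l * P - c * (l * Q)) ≡ - (l * l * Q) * (c * Q - P)
      numerator-expand = solve-∀
      denominator-expand : ∀ l P Q c D →
        (l * P - c * (l * Q)) * (l * P - c * (l * Q)) - l * l * D ≡ l * l * ((c * Q - P) * (c * Q - P) - D)
      denominator-expand = solve-∀
      denominator-collect : ∀ l Q Q′ → l * l * - (Q * Q′) ≡ - (l * l * Q) * Q′
      denominator-collect = solve-∀
      numerator : l * + Q * (l * + P - + c * (l * + Q)) ≡ - (l * l * + Q) * + P′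
      numerator = begin
        l * + Q * (l * + P - + c * (l * + Q))  ≡⟨ numerator-expand l (+ Q) (+ P) (+ c) ⟩
        - (l * l * + Q) * (+ c * + Q - + P)    ≡⟨ cong (- (l * l * + Q) *_) next-numerator ⟩
        - (l * l * + Q) * + P′                 ∎
      denominator : (l * + P - + c * (l * + Q)) * (l * + P - + c * (l * + Q)) - l * l * + D
        ≡ - (l * l * + Q) * + Q′
      denominator = begin
        (l * + P - + c * (l * + Q)) * (l * + P - + c * (l * + Q)) - l * l * + D
          ≡⟨ denominator-expand l (+ P) (+ Q) (+ c) (+ D) ⟩
        l * l * ((+ c * + Q - + P) * (+ c * + Q - + P) - + D)
          ≡⟨ cong (λ x → l * l * (x * x - + D)) next-numerator ⟩
        l * l * (+ P′ * + P′ - + D)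
          ≡⟨ cong (l * l *_) next-norm ⟩
        l * l * - (+ Q * + Q′)
          ≡⟨ denominator-collect l (+ Q) (+ Q′) ⟩
        - (l * l * + Q) * + Q′ ∎

  module Certified (P Q c : ℕ → ℕ) (P₀≡0 : P 0 ≡ 0) (Q₀≡1 : Q 0 ≡ 1)
                   (step : ∀ n → Step (P n) (Q n) (c n) (P (suc n)) (Q (suc n))) where

    completeQ-proportional : ∀ n → ∃ λ l → l ≢ 0ℤ × completeQ D (+_ ∘ c) n ≡ (l * + P n , l , l * + Q n)
    completeQ-proportional zero rewrite P₀≡0 | Q₀≡1 = 1ℤ , (λ ()) , refl
    completeQ-proportional (suc n) with completeQ-proportional n
    ... | l , l≢0 , eq =
      - (l * l * + Q n) ,
      (λ w≡0 → <⇒≢ (l*l*Q>0 l≢0 (Q>0 (step n))) (sym (neg-injective w≡0))) ,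
      trans (cong (λ x → recipStep D x (+ c n)) eq) (recipStep-proportional (step n) l)

    isFloor⇔floorBoundsₙ : ∀ n {x} → IsFloor D (completeQ D (+_ ∘ c) n) x ⇔ FloorBounds (P n) (Q n) x
    isFloor⇔floorBoundsₙ n {x} with completeQ-proportional n
    ... | l , l≢0 , eq rewrite eq = isFloor⇔floorBounds {c = x} l≢0 (Q>0 (step n))

    isCFsqrt : IsCFsqrt D (+_ ∘ c)
    isCFsqrt n = Equivalence.from (isFloor⇔floorBoundsₙ n {+ c n}) (step⇒floorBounds (step n))

    module _ {c′} (cf : IsCFsqrt D c′) where

      completeQ-agree : completeQ D c′ ≗ completeQ D (+_ ∘ c)
      digits-agree : c′ ≗ +_ ∘ c

      completeQ-agree zero = refl
      completeQ-agree (suc n) = cong₂ (recipStep D) (completeQ-agree n) (digits-agree n)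

      digits-agree n = floorBounds-unique
        (step⇒floorBounds (step n))
        (Equivalence.to (isFloor⇔floorBoundsₙ n {c′ n}) (subst (λ x → IsFloor D x (c′ n)) (completeQ-agree n) (cf n)))

open import Data.Nat.Base using (_+_; _*_; _^_; _∸_; _<_; _≤_; _<ᵇ_; _≡ᵇ_; _%_; _/_; s≤s; z<s; NonZero)
open ℕ-Solver using (solve-∀)

¬T⇒≡false : ∀ {b} → ¬ T b → b ≡ false
¬T⇒≡false {false} _ = refl
¬T⇒≡false {true} ¬t = contradiction _ ¬t

[2j]%2≡0 : ∀ j → 2 * j % 2 ≡ 0
[2j]%2≡0 j = trans (cong (_% 2) (ℕ.*-comm 2 j)) (m*n%n≡0 j 2)

[2j]/2≡j : ∀ j → 2 * j / 2 ≡ j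
[2j]/2≡j j = trans (cong (_/ 2) (ℕ.*-comm 2 j)) (m*n/n≡m j 2)

[1+2j]%2≡1 : ∀ j → suc (2 * j) % 2 ≡ 1
[1+2j]%2≡1 j = trans (cong (λ x → suc x % 2) (ℕ.*-comm 2 j)) ([m+kn]%n≡m%n 1 j 2)

[1+2j]/2≡j : ∀ j → suc (2 * j) / 2 ≡ j
[1+2j]/2≡j j = begin
  (1 + 2 * j) / 2        ≡⟨ +-distrib-/ 1 (2 * j) (subst (λ x → 1 + x < 2) (sym ([2j]%2≡0 j)) ℕ.≤-refl) ⟩
  1 / 2 + 2 * j / 2      ≡⟨ cong (1 / 2 +_) ([2j]/2≡j j) ⟩
  j                      ∎
  where open ≡-Reasoning

-- `alternate` and `Layout.at` have the shapes of `pIdx` and `block`, which are instances of them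
-- by definition.
alternate : ∀ {A : Set} → (ℕ → A) → (ℕ → A) → ℕ → A
alternate f g i = if i % 2 ≡ᵇ 0 then f (i / 2) else g (i / 2)

alternate-even : ∀ {A : Set} (f g : ℕ → A) j → alternate f g (2 * j) ≡ f j
alternate-even f g j rewrite [2j]%2≡0 j | [2j]/2≡j j = refl

alternate-odd : ∀ {A : Set} (f g : ℕ → A) j → alternate f g (suc (2 * j)) ≡ g j
alternate-odd f g j rewrite [1+2j]%2≡1 j | [1+2j]/2≡j j = refl

m+n≡o⇒o∸m≡n : ∀ m {n o} → m + n ≡ o → o ∸ m ≡ n
m+n≡o⇒o∸m≡n m {n} refl = ℕ.m+n∸m≡n m n

2k<4k+1 : ∀ k → 2 * k < 4 * k + 1
2k<4k+1 k = ℕ.≤-<-trans (ℕ.*-monoˡ-≤ k {2} {4} (s≤s (s≤s z≤n))) (ℕ.m<m+n (4 * k) z<s)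

parity : ∀ n → ∃ λ h → n ≡ 2 * h ⊎ n ≡ suc (2 * h)
parity zero = 0 , inj₁ refl
parity (suc n) with parity n
... | h , inj₁ n≡2h  = h , inj₂ (cong suc n≡2h)
... | h , inj₂ n≡1+2h = suc h , inj₁ (trans (cong suc n≡1+2h) (sym (ℕ.+-suc (suc h) (h + 0))))

m<n⇒∃[o]m+suc[o]≡n : ∀ {m n} → m < n → ∃ λ o → m + suc o ≡ n
m<n⇒∃[o]m+suc[o]≡n {m} m<n with ℕ.m≤n⇒∃[o]m+o≡n m<n
... | o , 1+m+o≡n = o , trans (ℕ.+-suc m o) 1+m+o≡n

m<n⇒∃[o]o+suc[m]≡n : ∀ {m n} → m < n → ∃ λ o → o + suc m ≡ n
m<n⇒∃[o]o+suc[m]≡n {m} m<n with ℕ.m≤n⇒∃[o]m+o≡n m<n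
... | o , 1+m+o≡n = o , trans (ℕ.+-comm o (suc m)) 1+m+o≡n

module Layout {A : Set} (k : ℕ) (ascending : ℕ → A) (middle : A) (descending : ℕ → A) (last : A) where

  at : ℕ → A
  at i =
    if i <ᵇ 2 * k then ascending i
    else if i ≡ᵇ 2 * k then middle
    else if i <ᵇ 4 * k + 1 then descending (4 * k ∸ i)
    else last

  at-ascending : ∀ {i} → i < 2 * k → at i ≡ ascending i
  at-ascending i<2k rewrite Equivalence.to T-≡ (ℕ.<⇒<ᵇ i<2k) = refl

  at-middle : at (2 * k) ≡ middle
  at-middle
    rewrite ¬T⇒≡false (λ t → ℕ.<-irrefl refl (ℕ.<ᵇ⇒< (2 * k) _ t))
          | Equivalence.to T-≡ (ℕ.≡⇒≡ᵇ (2 * k) _ refl) = refl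

  at-descending : ∀ {i} → 2 * k < i → i < 4 * k + 1 → at i ≡ descending (4 * k ∸ i)
  at-descending {i} 2k<i i<4k+1
    rewrite ¬T⇒≡false (λ t → ℕ.<-asym 2k<i (ℕ.<ᵇ⇒< i _ t))
          | ¬T⇒≡false (λ t → ℕ.<-irrefl (sym (ℕ.≡ᵇ⇒≡ i _ t)) 2k<i)
          | Equivalence.to T-≡ (ℕ.<⇒<ᵇ i<4k+1) = refl

  at-reflected : ∀ d d′ → d + d′ ≡ 2 * k → 0 < d → at (2 * k + d) ≡ descending d′
  at-reflected d d′ d+d′≡2k d>0 =
    trans (at-descending (ℕ.m<m+n (2 * k) d>0) 2k+d<4k+1) (cong descending reflect)
    where
    double : ∀ k → 4 * k ≡ 2 * k + 2 * k
    double = solve-∀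
    4k≡2k+2k : 4 * k ≡ 2 * k + 2 * k
    4k≡2k+2k = double k
    2k+d<4k+1 : 2 * k + d < 4 * k + 1
    2k+d<4k+1 = ℕ.≤-<-trans
      (subst (2 * k + d ≤_) (sym 4k≡2k+2k) (ℕ.+-monoʳ-≤ (2 * k) (subst (d ≤_) d+d′≡2k (ℕ.m≤m+n d d′))))
      (ℕ.m<m+n (4 * k) z<s)
    reflect : 4 * k ∸ (2 * k + d) ≡ d′
    reflect = begin
      4 * k ∸ (2 * k + d)          ≡⟨ cong (_∸ (2 * k + d)) 4k≡2k+2k ⟩
      2 * k + 2 * k ∸ (2 * k + d)  ≡⟨ ℕ.[m+n]∸[m+o]≡n∸o (2 * k) (2 * k) d ⟩
      2 * k ∸ d                    ≡⟨ m+n≡o⇒o∸m≡n d d+d′≡2k ⟩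
      d′                           ∎
      where open ≡-Reasoning

  at-last : at (4 * k + 1) ≡ last
  at-last
    rewrite ¬T⇒≡false (λ t → ℕ.<⇒≱ (ℕ.<ᵇ⇒< (4 * k + 1) _ t) (ℕ.<⇒≤ (2k<4k+1 k)))
          | ¬T⇒≡false (λ t → ℕ.<⇒≢ (2k<4k+1 k) (sym (ℕ.≡ᵇ⇒≡ (4 * k + 1) _ t)))
          | ¬T⇒≡false (λ t → ℕ.<-irrefl refl (ℕ.<ᵇ⇒< (4 * k + 1) _ t)) = refl

module Expansion (a m s k : ℕ) (a>0 : 0 < a) (m>0 : 0 < m) (s>0 : 0 < s) (k>0 : 0 < k) where

  -- The numerators of the complete quotients take only the values a₀ = ⌊√D⌋ and a₀′ = a₀ − E.
  r R a₀ E a₀′ : ℕ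
  r = 1 + 2 * a * m * s
  R = r ^ k
  a₀ = m * (s + a * R)
  E = 2 * m * s
  a₀′ = a₀ ∸ E

  D : ℕ
  D = m * (2 * R + m * ((s + a * R) * (s + a * R)))

  k′ : ℕ
  k′ = ℕ.pred k

  1+k′≡k : suc k′ ≡ k
  1+k′≡k = ℕ.suc-pred k {{ℕ.>-nonZero k>0}}

  instance
    a≢0 : NonZero a
    a≢0 = ℕ.>-nonZero a>0
    m≢0 : NonZero m
    m≢0 = ℕ.>-nonZero m>0
    r≢0 : NonZero r
    r≢0 = _

  D≡a₀²+2mR : D ≡ a₀ * a₀ + 2 * m * R
  D≡a₀²+2mR = lemma m s a R
    where
    lemma : ∀ m s a R → m * (2 * R + m * ((s + a * R) * (s + a * R))) ≡ m * (s + a * R) * (m * (s + a * R)) + 2 * m * R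
    lemma = solve-∀

  a₀²≤D : a₀ * a₀ ≤ D
  a₀²≤D = subst (a₀ * a₀ ≤_) (sym D≡a₀²+2mR) (ℕ.m≤m+n _ _)

  D<[1+a₀]² : D < suc a₀ * suc a₀
  D<[1+a₀]² = subst₂ _<_ (sym D≡a₀²+2mR) (sym (square-suc a₀)) (ℕ.+-monoʳ-< (a₀ * a₀) (s≤s 2mR≤a₀+a₀))
    where
    square-suc : ∀ x → suc x * suc x ≡ x * x + suc (x + x)
    square-suc = solve-∀
    2mR≤a₀+a₀ : 2 * m * R ≤ a₀ + a₀
    2mR≤a₀+a₀ = subst₂ _≤_ (double m R) (twice (m * (s + a * R)))
      (ℕ.*-monoʳ-≤ 2 (ℕ.*-monoʳ-≤ m (ℕ.≤-trans (ℕ.m≤n*m R a) (ℕ.m≤n+m (a * R) s))))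
      where
      double : ∀ m x → 2 * (m * x) ≡ 2 * m * x
      double = solve-∀
      twice : ∀ x → 2 * x ≡ x + x
      twice = solve-∀

  open SqrtExpansion D a₀ a₀²≤D D<[1+a₀]²

  r^n>0 : ∀ n → 0 < r ^ n
  r^n>0 = ℕ.m^n>0 r

  r≤r^[1+n] : ∀ n → r ≤ r ^ suc n
  r≤r^[1+n] n = ℕ.m≤m*n r (r ^ n) {{ℕ.>-nonZero (r^n>0 n)}}

  E<r : E < r
  E<r = s≤s (ℕ.*-monoˡ-≤ s (ℕ.*-monoˡ-≤ m (ℕ.m≤m*n 2 a)))

  E<r^[1+n] : ∀ n → E < r ^ suc n
  E<r^[1+n] n = ℕ.<-≤-trans E<r (r≤r^[1+n] n)

  E<2mr^[1+n] : ∀ n → E < 2 * m * r ^ suc n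
  E<2mr^[1+n] n = ℕ.<-≤-trans (E<r^[1+n] n) (ℕ.m≤n*m (r ^ suc n) (2 * m) {{ℕ.m*n≢0 2 m}})

  2mr^n>0 : ∀ n → 0 < 2 * m * r ^ n
  2mr^n>0 n = ℕ.<-≤-trans (r^n>0 n) (ℕ.m≤n*m (r ^ n) (2 * m) {{ℕ.m*n≢0 2 m}})

  s≤aR : s ≤ a * R
  s≤aR = begin
    s      ≤⟨ ℕ.m≤n*m s (2 * m) {{ℕ.m*n≢0 2 m}} ⟩
    E      <⟨ E<r ⟩
    r      ≤⟨ r≤R ⟩
    R      ≤⟨ ℕ.m≤n*m R a ⟩
    a * R  ∎
    where
    open ℕ.≤-Reasoning
    r≤R : r ≤ R
    r≤R = subst (λ n → r ≤ r ^ n) 1+k′≡k (r≤r^[1+n] k′)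

  E≤a₀ : E ≤ a₀
  E≤a₀ = subst₂ _≤_ (sym (double m s)) (sym (ℕ.*-distribˡ-+ m s (a * R)))
    (ℕ.+-monoʳ-≤ (m * s) (ℕ.*-monoʳ-≤ m s≤aR))
    where
    double : ∀ m s → 2 * m * s ≡ m * s + m * s
    double = solve-∀

  a₀′+E≡a₀ : a₀′ + E ≡ a₀
  a₀′+E≡a₀ = ℕ.m∸n+n≡m E≤a₀

  a₀′+a₀≡2amR : a₀′ + a₀ ≡ 2 * a * m * R
  a₀′+a₀≡2amR = ℕ.+-cancelʳ-≡ E _ _ (begin
    a₀′ + a₀ + E       ≡⟨ ℕ.+-assoc a₀′ a₀ E ⟩
    a₀′ + (a₀ + E)     ≡⟨ cong (a₀′ +_) (ℕ.+-comm a₀ E) ⟩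
    a₀′ + (E + a₀)     ≡⟨ ℕ.+-assoc a₀′ E a₀ ⟨
    a₀′ + E + a₀       ≡⟨ cong (_+ a₀) a₀′+E≡a₀ ⟩
    a₀ + a₀            ≡⟨ doubled m s a R ⟩
    2 * a * m * R + E  ∎)
    where
    open ≡-Reasoning
    doubled : ∀ m s a R → m * (s + a * R) + m * (s + a * R) ≡ 2 * a * m * R + 2 * m * s
    doubled = solve-∀

  arrive-high : ∀ {P Q c Q′} → c * Q ≡ P + a₀ → Q * Q′ ≡ 2 * m * R → 0 < Q → Step P Q c a₀ Q′
  arrive-high {P} {Q} {c} {Q′} quotient QQ′≡2mR Q>0 = record
    { quotient = quotient
    ; norm     = trans (cong (_+ a₀ * a₀) QQ′≡2mR) (trans (ℕ.+-comm (2 * m * R) (a₀ * a₀)) (sym D≡a₀²+2mR))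
    ; Q>0      = Q>0
    ; P′≤a₀    = ℕ.≤-refl
    ; a₀<P′+Q  = ℕ.m<m+n a₀ Q>0
    }

  high→low : ∀ {Q c Q′} → c * Q ≡ 2 * a * m * R → Q * Q′ ≡ 2 * m * r ^ suc k → E < Q → Step a₀ Q c a₀′ Q′
  high→low {Q} {c} {Q′} cQ≡2amR QQ′≡2mrR E<Q = record
    { quotient = trans cQ≡2amR (trans (sym a₀′+a₀≡2amR) (ℕ.+-comm a₀′ a₀))
    ; norm     = trans (cong (_+ a₀′ * a₀′) QQ′≡2mrR) norm
    ; Q>0      = ℕ.≤-<-trans z≤n E<Q
    ; P′≤a₀    = subst (a₀′ ≤_) a₀′+E≡a₀ (ℕ.m≤m+n a₀′ E)
    ; a₀<P′+Q  = subst (_< a₀′ + Q) a₀′+E≡a₀ (ℕ.+-monoʳ-< a₀′ E<Q)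
    }
    where
    open ≡-Reasoning
    norm : 2 * m * r ^ suc k + a₀′ * a₀′ ≡ D
    norm = begin
      2 * m * (r * R) + a₀′ * a₀′
        ≡⟨ expand a m s R a₀′ ⟩
      2 * m * R + E * (2 * a * m * R) + a₀′ * a₀′
        ≡⟨ cong (λ x → 2 * m * R + E * x + a₀′ * a₀′) a₀′+a₀≡2amR ⟨
      2 * m * R + E * (a₀′ + a₀) + a₀′ * a₀′
        ≡⟨ cong (λ x → 2 * m * R + E * (a₀′ + x) + a₀′ * a₀′) a₀′+E≡a₀ ⟨
      2 * m * R + E * (a₀′ + (a₀′ + E)) + a₀′ * a₀′
        ≡⟨ square E a₀′ (2 * m * R) ⟩
      (a₀′ + E) * (a₀′ + E) + 2 * m * R
        ≡⟨ cong (λ x → x * x + 2 * m * R) a₀′+E≡a₀ ⟩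
      a₀ * a₀ + 2 * m * R
        ≡⟨ D≡a₀²+2mR ⟨
      D ∎
      where
      expand : ∀ a m s R x → 2 * m * ((1 + 2 * a * m * s) * R) + x * x ≡ 2 * m * R + 2 * m * s * (2 * a * m * R) + x * x
      expand = solve-∀
      square : ∀ e x y → y + e * (x + (x + e)) + x * x ≡ (x + e) * (x + e) + y
      square = solve-∀

  low→high : ∀ {Q c Q′} → c * Q ≡ 2 * a * m * R → Q * Q′ ≡ 2 * m * R → 0 < Q → Step a₀′ Q c a₀ Q′
  low→high cQ≡2amR = arrive-high (trans cQ≡2amR (sym a₀′+a₀≡2amR))

  high→high : ∀ {Q c Q′} → c * Q ≡ 2 * m * (s + a * R) → Q * Q′ ≡ 2 * m * R → 0 < Q → Step a₀ Q c a₀ Q′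
  high→high cQ≡2a₀ = arrive-high (trans cQ≡2a₀ (double m (s + a * R)))
    where
    double : ∀ m x → 2 * m * x ≡ m * x + m * x
    double = solve-∀

  r^-split : ∀ u v {n} → u + v ≡ n → r ^ u * r ^ v ≡ r ^ n
  r^-split u v u+v≡n = trans (sym (ℕ.^-distribˡ-+-* r u v)) (cong (r ^_) u+v≡n)

  2m-first : ∀ u v {n} → u + v ≡ n → 2 * m * r ^ u * r ^ v ≡ 2 * m * r ^ n
  2m-first u v u+v≡n = trans (ℕ.*-assoc (2 * m) (r ^ u) _) (cong (2 * m *_) (r^-split u v u+v≡n))

  2m-second : ∀ u v {n} → u + v ≡ n → r ^ u * (2 * m * r ^ v) ≡ 2 * m * r ^ n
  2m-second u v u+v≡n = trans (ℕ.*-comm (r ^ u) _) (2m-first v u (trans (ℕ.+-comm v u) u+v≡n))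

  even-quotient : ∀ u v → u + v ≡ k → a * r ^ u * (2 * m * r ^ v) ≡ 2 * a * m * R
  even-quotient u v u+v≡k = trans (regroup a m (r ^ u) (r ^ v)) (cong (2 * a * m *_) (r^-split u v u+v≡k))
    where
    regroup : ∀ a m x y → a * x * (2 * m * y) ≡ 2 * a * m * (x * y)
    regroup = solve-∀

  odd-quotient : ∀ u v → u + v ≡ k → 2 * a * m * r ^ v * r ^ u ≡ 2 * a * m * R
  odd-quotient u v u+v≡k =
    trans (ℕ.*-assoc (2 * a * m) (r ^ v) _) (cong (2 * a * m *_) (r^-split v u (trans (ℕ.+-comm v u) u+v≡k)))

  -- Denominators 2m r^(k-j) at index 2j and r^(j+1) at index 2j+1 of the first half, read
  -- backwards in the second half; 2m r^0 and r^0 continue the pattern at 2k and 4k+1.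
  halfDenominator : ℕ → ℕ
  halfDenominator = alternate (λ j → 2 * m * r ^ (k ∸ j)) (λ j → r ^ suc j)

  module Numerator = Layout k (alternate (λ _ → a₀) (λ _ → a₀′)) a₀ (alternate (λ _ → a₀′) (λ _ → a₀)) a₀
  module Denominator = Layout k halfDenominator (2 * m * r ^ 0) halfDenominator (r ^ 0)
  module Quotient = Layout k (pIdx a m r k) (s + a * R) (pIdx a m r k) (2 * m * (s + a * R))

  numerator denominator quotient : ℕ → ℕ
  numerator = Numerator.at
  denominator = Denominator.at
  quotient = Quotient.at

  Entry : ℕ → ℕ → ℕ → Set
  Entry i P Q = numerator i ≡ P × denominator i ≡ Q

  Values : ℕ → ℕ → ℕ → ℕ → Set
  Values i P Q c = Entry i P Q × quotient i ≡ c

  Advance : ℕ → ℕ → Set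
  Advance i i′ = Step (numerator i) (denominator i) (quotient i) (numerator i′) (denominator i′)

  Entry-resp : ∀ {i i′ P Q} → i′ ≡ i → Entry i′ P Q → Entry i P Q
  Entry-resp refl entry = entry

  advance : ∀ {i i′ P Q c P′ Q′} → Values i P Q c → Entry i′ P′ Q′ → Step P Q c P′ Q′ → Advance i i′
  advance ((refl , refl) , refl) (refl , refl) step = step

  halfDenominator-odd : ∀ j → halfDenominator (suc (2 * j)) ≡ r ^ suc j
  halfDenominator-odd j = alternate-odd (λ j → 2 * m * r ^ (k ∸ j)) (λ j → r ^ suc j) j

  pIdx-even : ∀ j → pIdx a m r k (2 * j) ≡ a * r ^ j
  pIdx-even j = alternate-even (λ j → a * r ^ j) (λ j → 2 * a * m * r ^ (k ∸ 1 ∸ j)) j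

  module _ (j t : ℕ) (j+1+t≡k : j + suc t ≡ k) where

    j<k : j < k
    j<k = subst (j <_) j+1+t≡k (ℕ.m<m+n j z<s)

    t<k : t < k
    t<k = subst (suc t ≤_) j+1+t≡k (ℕ.m≤n+m (suc t) j)

    2j<2k : 2 * j < 2 * k
    2j<2k = ℕ.*-monoʳ-< 2 j<k

    1+2j<2k : suc (2 * j) < 2 * k
    1+2j<2k = ℕ.<-≤-trans (ℕ.n<1+n _) (subst (_≤ 2 * k) (two-suc j) (ℕ.*-monoʳ-≤ 2 j<k))
      where
      two-suc : ∀ j → 2 * suc j ≡ suc (suc (2 * j))
      two-suc = solve-∀

    halfDenominator-even : halfDenominator (2 * j) ≡ 2 * m * r ^ suc t
    halfDenominator-even = trans (alternate-even (λ j → 2 * m * r ^ (k ∸ j)) (λ j → r ^ suc j) j)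
      (cong (λ n → 2 * m * r ^ n) (m+n≡o⇒o∸m≡n j j+1+t≡k))

    pIdx-odd : pIdx a m r k (suc (2 * j)) ≡ 2 * a * m * r ^ t
    pIdx-odd = trans (alternate-odd (λ j → a * r ^ j) (λ j → 2 * a * m * r ^ (k ∸ 1 ∸ j)) j)
      (cong (λ n → 2 * a * m * r ^ n) (trans (ℕ.∸-+-assoc k 1 j) (m+n≡o⇒o∸m≡n (suc j) 1+j+t≡k)))
      where
      1+j+t≡k : suc j + t ≡ k
      1+j+t≡k = trans (sym (ℕ.+-suc j t)) j+1+t≡k

    values-ascendingEven : Values (2 * j) a₀ (2 * m * r ^ suc t) (a * r ^ j)
    values-ascendingEven =
      (trans (Numerator.at-ascending 2j<2k) (alternate-even (λ _ → a₀) (λ _ → a₀′) j) ,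
       trans (Denominator.at-ascending 2j<2k) halfDenominator-even) ,
      trans (Quotient.at-ascending 2j<2k) (pIdx-even j)

    values-ascendingOdd : Values (suc (2 * j)) a₀′ (r ^ suc j) (2 * a * m * r ^ t)
    values-ascendingOdd =
      (trans (Numerator.at-ascending 1+2j<2k) (alternate-odd (λ _ → a₀) (λ _ → a₀′) j) ,
       trans (Denominator.at-ascending 1+2j<2k) (halfDenominator-odd j)) ,
      trans (Quotient.at-ascending 1+2j<2k) pIdx-odd

    values-descendingOdd : Values (2 * k + suc (2 * t)) a₀ (r ^ suc j) (2 * a * m * r ^ t)
    values-descendingOdd =
      (trans (Numerator.at-reflected _ _ odd-split z<s) (alternate-odd (λ _ → a₀′) (λ _ → a₀) j) ,
       trans (Denominator.at-reflected _ _ odd-split z<s) (halfDenominator-odd j)) ,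
      trans (Quotient.at-reflected _ _ odd-split z<s) pIdx-odd
      where
      odd-split : suc (2 * t) + suc (2 * j) ≡ 2 * k
      odd-split = trans (split j t) (cong (2 *_) j+1+t≡k)
        where
        split : ∀ j t → suc (2 * t) + suc (2 * j) ≡ 2 * (j + suc t)
        split = solve-∀

    values-descendingEven : Values (2 * k + suc (suc (2 * t))) a₀′ (2 * m * r ^ suc t) (a * r ^ j)
    values-descendingEven =
      (trans (Numerator.at-reflected _ _ even-split z<s) (alternate-even (λ _ → a₀′) (λ _ → a₀) j) ,
       trans (Denominator.at-reflected _ _ even-split z<s) halfDenominator-even) ,
      trans (Quotient.at-reflected _ _ even-split z<s) (pIdx-even j)
      where
      even-split : suc (suc (2 * t)) + 2 * j ≡ 2 * k
      even-split = trans (split j t) (cong (2 *_) j+1+t≡k)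
        where
        split : ∀ j t → suc (suc (2 * t)) + 2 * j ≡ 2 * (j + suc t)
        split = solve-∀

  values-middle : Values (2 * k) a₀ (2 * m * r ^ 0) (s + a * R)
  values-middle = (Numerator.at-middle , Denominator.at-middle) , Quotient.at-middle

  values-last : Values (4 * k + 1) a₀ (r ^ 0) (2 * m * (s + a * R))
  values-last = (Numerator.at-last , Denominator.at-last) , Quotient.at-last

  -- A position in the block; j + t + 1 = k records how r^k splits as r^j · r^(t+1) there.
  data Position (i : ℕ) : Set where
    ascendingEven  : ∀ j t → j + suc t ≡ k → i ≡ 2 * j → Position i
    ascendingOdd   : ∀ j t → j + suc t ≡ k → i ≡ suc (2 * j) → Position i
    middle         : i ≡ 2 * k → Position i
    descendingOdd  : ∀ j t → j + suc t ≡ k → i ≡ 2 * k + suc (2 * t) → Position i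
    descendingEven : ∀ j t → j + suc t ≡ k → i ≡ 2 * k + suc (suc (2 * t)) → Position i
    last           : i ≡ 4 * k + 1 → Position i

  advance-within : ∀ {i} → Position i → i < 4 * k + 1 → Advance i (suc i)
  advance-within (ascendingEven j t e refl) _ =
    advance (values-ascendingEven j t e) (proj₁ (values-ascendingOdd j t e))
      (high→low (even-quotient j (suc t) e)
                (2m-first (suc t) (suc j) (trans (ℕ.+-comm (suc t) (suc j)) (cong suc e)))
                (E<2mr^[1+n] t))
  advance-within (ascendingOdd j t e refl) _ =
    advance (values-ascendingOdd j t e) (next t e)
      (low→high (odd-quotient (suc j) t e′) (2m-second (suc j) t e′) (r^n>0 (suc j)))
    where
    e′ : suc j + t ≡ k
    e′ = trans (sym (ℕ.+-suc j t)) e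
    next : ∀ t → j + suc t ≡ k → Entry (suc (suc (2 * j))) a₀ (2 * m * r ^ t)
    next zero    e = Entry-resp (trans (cong (2 *_) (sym e)) (index j)) (proj₁ values-middle)
      where
      index : ∀ j → 2 * (j + 1) ≡ suc (suc (2 * j))
      index = solve-∀
    next (suc t) e = Entry-resp (index j) (proj₁ (values-ascendingEven (suc j) t (trans (sym (ℕ.+-suc j (suc t))) e)))
      where
      index : ∀ j → 2 * suc j ≡ suc (suc (2 * j))
      index = solve-∀
  advance-within (middle refl) _ =
    advance values-middle
      (Entry-resp (ℕ.+-comm (2 * k) 1) (proj₁ (values-descendingOdd k′ 0 (trans (ℕ.+-comm k′ 1) 1+k′≡k))))
      (high→high (commute m (s + a * R)) (2m-first 0 (suc k′) 1+k′≡k) (2mr^n>0 0))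
    where
    commute : ∀ m x → x * (2 * m * 1) ≡ 2 * m * x
    commute = solve-∀
  advance-within (descendingOdd j t e refl) _ =
    advance (values-descendingOdd j t e) (Entry-resp (ℕ.+-suc (2 * k) (suc (2 * t))) (proj₁ (values-descendingEven j t e)))
      (high→low (odd-quotient (suc j) t (trans (sym (ℕ.+-suc j t)) e))
                (2m-second (suc j) (suc t) (cong suc e))
                (E<r^[1+n] j))
  advance-within (descendingEven j t e refl) _ =
    advance (values-descendingEven j t e) (next j e)
      (low→high (even-quotient j (suc t) e)
                (2m-first (suc t) j (trans (ℕ.+-comm (suc t) j) e))
                (2mr^n>0 (suc t)))
    where
    next : ∀ j → j + suc t ≡ k → Entry (suc (2 * k + suc (suc (2 * t)))) a₀ (r ^ j)
    next zero    e = Entry-resp (subst (λ k → 4 * k + 1 ≡ suc (2 * k + suc (suc (2 * t)))) e (index t)) (proj₁ values-last)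
      where
      index : ∀ t → 4 * suc t + 1 ≡ suc (2 * suc t + suc (suc (2 * t)))
      index = solve-∀
    next (suc j) e = Entry-resp (index (2 * k) t) (proj₁ (values-descendingOdd j (suc t) (trans (ℕ.+-suc j (suc t)) e)))
      where
      index : ∀ K t → K + suc (2 * suc t) ≡ suc (K + suc (suc (2 * t)))
      index = solve-∀
  advance-within (last refl) 4k+1<4k+1 = contradiction 4k+1<4k+1 (ℕ.<-irrefl refl)

  arrive : ∀ {i P Q c P′ Q′} → Entry i P′ Q′ → Step P Q c P′ Q′ → Step P Q c (numerator i) (denominator i)
  arrive (refl , refl) step = step

  start : Step 0 1 a₀ (numerator 0) (denominator 0)
  start = arrive (proj₁ (values-ascendingEven 0 k′ 1+k′≡k))
    (arrive-high (ℕ.*-identityʳ a₀) (2m-second 0 (suc k′) 1+k′≡k) z<s)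

  advance-wrap : Advance (4 * k + 1) 0
  advance-wrap = advance values-last (proj₁ (values-ascendingEven 0 k′ 1+k′≡k))
    (high→high (ℕ.*-identityʳ _) (2m-second 0 (suc k′) 1+k′≡k) z<s)

  descending : ∀ d → suc (2 * k + d) ≤ 4 * k + 1 → Position (suc (2 * k + d))
  descending d bound with parity d
  ... | h , inj₁ refl with h ℕ.<? k
  ...   | yes h<k = let j , e = m<n⇒∃[o]o+suc[m]≡n h<k in descendingOdd j h e (sym (ℕ.+-suc (2 * k) (2 * h)))
  ...   | no h≮k  = last (ℕ.≤-antisym bound (subst (_≤ suc (2 * k + 2 * h)) (index k)
                        (s≤s (ℕ.+-monoʳ-≤ (2 * k) (ℕ.*-monoʳ-≤ 2 (ℕ.≮⇒≥ h≮k))))))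
    where
    index : ∀ k → suc (2 * k + 2 * k) ≡ 4 * k + 1
    index = solve-∀
  descending d bound | h , inj₂ refl with h ℕ.<? k
  ...   | yes h<k = let j , e = m<n⇒∃[o]o+suc[m]≡n h<k in descendingEven j h e (sym (ℕ.+-suc (2 * k) (suc (2 * h))))
  ...   | no h≮k  = contradiction bound (ℕ.<⇒≱ (subst (_≤ suc (2 * k + suc (2 * h))) (index k)
                        (s≤s (ℕ.+-monoʳ-≤ (2 * k) (s≤s (ℕ.*-monoʳ-≤ 2 (ℕ.≮⇒≥ h≮k)))))))
    where
    index : ∀ k → suc (2 * k + suc (2 * k)) ≡ suc (4 * k + 1)
    index = solve-∀

  position : ∀ {i} → i ≤ 4 * k + 1 → Position i
  position {i} i≤4k+1 with ℕ.<-cmp i (2 * k)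
  ... | tri≈ _ i≡2k _ = middle i≡2k
  ... | tri> _ _ 2k<i with ℕ.m≤n⇒∃[o]m+o≡n 2k<i
  ...   | d , refl = descending d i≤4k+1
  position {i} _ | tri< i<2k _ _ with parity i
  ...   | h , inj₁ refl =
    let t , e = m<n⇒∃[o]m+suc[o]≡n (ℕ.*-cancelˡ-< 2 h k i<2k) in ascendingEven h t e refl
  ...   | h , inj₂ refl =
    let t , e = m<n⇒∃[o]m+suc[o]≡n (ℕ.*-cancelˡ-< 2 h k (ℕ.<-trans (ℕ.n<1+n _) i<2k)) in ascendingOdd h t e refl

  L : ℕ
  L = 2 + 4 * k

  numerators denominators digits : ℕ → ℕ
  numerators zero    = 0
  numerators (suc n) = numerator (n % L)
  denominators zero    = 1
  denominators (suc n) = denominator (n % L)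
  digits zero    = a₀
  digits (suc n) = quotient (n % L)

  digits≗cfPattern : ℤ.+_ ∘ digits ≗ cfPattern a m s k
  digits≗cfPattern zero    = refl
  digits≗cfPattern (suc n) = refl

  4k+2≡L : 4 * k + 2 ≡ L
  4k+2≡L = ℕ.+-comm (4 * k) 2

  remainder≤4k+1 : ∀ n → n % L ≤ 4 * k + 1
  remainder≤4k+1 n = subst (n % L ≤_) (ℕ.+-comm 1 (4 * k)) (ℕ.≤-pred (m%n<n n L))

  step : ∀ n → Step (numerators n) (denominators n) (digits n) (numerators (suc n)) (denominators (suc n))
  step zero    = start
  step (suc n) with ℕ.m≤n⇒m<n∨m≡n (remainder≤4k+1 n)
  ... | inj₁ i<4k+1 = subst (Advance (n % L)) (sym next≡) (advance-within (position (ℕ.<⇒≤ i<4k+1)) i<4k+1)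
    where
    next≡ : suc n % L ≡ suc (n % L)
    next≡ = trans (%-distribˡ-+ 1 n L) (m<n⇒m%n≡m (s≤s (subst (suc (n % L) ≤_) (ℕ.+-comm (4 * k) 1) i<4k+1)))
  ... | inj₂ i≡4k+1 = subst₂ Advance (sym i≡4k+1) (sym next≡) advance-wrap
    where
    next≡ : suc n % L ≡ 0
    next≡ = begin
      suc n % L              ≡⟨ %-distribˡ-+ 1 n L ⟩
      suc (n % L) % L        ≡⟨ cong (λ i → suc i % L) i≡4k+1 ⟩
      suc (4 * k + 1) % L    ≡⟨ cong (λ i → suc i % L) (ℕ.+-comm (4 * k) 1) ⟩
      L % L                  ≡⟨ n%n≡0 L ⟩
      0                      ∎
      where open ≡-Reasoning

  peak : ℕ
  peak = 2 * m * (s + a * R)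

  ar^n<s+aR : ∀ {n} → n ≤ k → a * r ^ n < s + a * R
  ar^n<s+aR n≤k = ℕ.≤-<-trans (ℕ.*-monoʳ-≤ a (ℕ.^-monoʳ-≤ r n≤k)) (ℕ.m<n+m (a * R) s>0)

  ar^n<peak : ∀ {n} → n ≤ k → a * r ^ n < peak
  ar^n<peak n≤k = ℕ.<-≤-trans (ar^n<s+aR n≤k) (ℕ.m≤n*m _ (2 * m) {{ℕ.m*n≢0 2 m}})

  2amr^n<peak : ∀ {n} → n ≤ k → 2 * a * m * r ^ n < peak
  2amr^n<peak {n} n≤k = subst (_< peak) (regroup a m (r ^ n)) (ℕ.*-monoʳ-< (2 * m) {{ℕ.m*n≢0 2 m}} (ar^n<s+aR n≤k))
    where
    regroup : ∀ a m x → 2 * m * (a * x) ≡ 2 * a * m * x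
    regroup = solve-∀

  s+aR<peak : s + a * R < peak
  s+aR<peak = subst (_< peak) (ℕ.*-identityˡ (s + a * R))
    (ℕ.*-monoˡ-< (s + a * R) {{ℕ.>-nonZero (ℕ.<-≤-trans s>0 (ℕ.m≤m+n s _))}} (ℕ.*-monoʳ-≤ 2 m>0))

  below : ∀ {i P Q c} → Values i P Q c → c < peak → quotient i < peak
  below (_ , refl) c<peak = c<peak

  quotient<peak : ∀ {i} → Position i → i < 4 * k + 1 → quotient i < peak
  quotient<peak (ascendingEven j t e refl) _  = below (values-ascendingEven j t e) (ar^n<peak (ℕ.<⇒≤ (j<k j t e)))
  quotient<peak (ascendingOdd j t e refl) _   = below (values-ascendingOdd j t e) (2amr^n<peak (ℕ.<⇒≤ (t<k j t e)))
  quotient<peak (middle refl) _               = below values-middle s+aR<peak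
  quotient<peak (descendingOdd j t e refl) _  = below (values-descendingOdd j t e) (2amr^n<peak (ℕ.<⇒≤ (t<k j t e)))
  quotient<peak (descendingEven j t e refl) _ = below (values-descendingEven j t e) (ar^n<peak (ℕ.<⇒≤ (j<k j t e)))
  quotient<peak (last refl) 4k+1<4k+1         = contradiction 4k+1<4k+1 (ℕ.<-irrefl refl)

  isPeriod : IsPeriod (cfPattern a m s k) (4 * k + 2)
  isPeriod (suc n) _ = cong (λ i → ℤ.+ quotient i) (trans (cong (λ p → (n + p) % L) 4k+2≡L) ([m+n]%n≡m%n n L))

  no-shorter-period : ∀ p → 0 < p → p ≤ 4 * k + 1 → ¬ IsPeriod (cfPattern a m s k) p
  no-shorter-period p p>0 p≤4k+1 per =
    ℕ.<-irrefl repeat (subst (quotient i <_) peak≡ (quotient<peak (position (ℕ.<⇒≤ i<4k+1)) i<4k+1))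
    where
    i = 4 * k + 1 ∸ p
    i+p≡4k+1 : i + p ≡ 4 * k + 1
    i+p≡4k+1 = ℕ.m∸n+n≡m p≤4k+1
    i<4k+1 : i < 4 * k + 1
    i<4k+1 = subst (i <_) i+p≡4k+1 (ℕ.m<m+n i p>0)
    remainder : ∀ {j} → j ≤ 4 * k + 1 → j % L ≡ j
    remainder {j} j≤4k+1 = m<n⇒m%n≡m (s≤s (subst (j ≤_) (ℕ.+-comm (4 * k) 1) j≤4k+1))
    peak≡ : peak ≡ quotient (4 * k + 1)
    peak≡ = sym (proj₂ values-last)
    repeat : quotient i ≡ quotient (4 * k + 1)
    repeat = begin
      quotient i                  ≡⟨ cong quotient (remainder (ℕ.<⇒≤ i<4k+1)) ⟨
      quotient (i % L)            ≡⟨ +-injective (per (suc i) (s≤s z≤n)) ⟨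
      quotient ((i + p) % L)      ≡⟨ cong (λ j → quotient (j % L)) i+p≡4k+1 ⟩
      quotient ((4 * k + 1) % L)  ≡⟨ cong quotient (remainder ℕ.≤-refl) ⟩
      quotient (4 * k + 1)        ∎
      where open ≡-Reasoning

  fundamentalPeriod : FundamentalPeriod (cfPattern a m s k) (4 * k + 2)
  fundamentalPeriod = 4k+2>0 , isPeriod , λ p p>0 per → ℕ.≮⇒≥ λ p<4k+2 →
    no-shorter-period p p>0 (ℕ.≤-pred (subst (p <_) (ℕ.+-suc (4 * k) 1) p<4k+2)) per
    where
    4k+2>0 : 0 < 4 * k + 2
    4k+2>0 = subst (0 <_) (sym 4k+2≡L) z<s

theorem2 : (a m s k : ℕ) → 0 < a → 0 < m → 0 < s → 0 < k →
    IsCFsqrt (m * (2 * (1 + 2 * a * m * s) ^ k + m * ((s + a * (1 + 2 * a * m * s) ^ k) * (s + a * (1 + 2 * a * m * s) ^ k)))) (cfPattern a m s k)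
      × (∀ c → IsCFsqrt (m * (2 * (1 + 2 * a * m * s) ^ k + m * ((s + a * (1 + 2 * a * m * s) ^ k) * (s + a * (1 + 2 * a * m * s) ^ k)))) c → FundamentalPeriod c (4 * k + 2))
theorem2 a m s k a>0 m>0 s>0 k>0 =
  IsCFsqrt-cong digits≗cfPattern isCFsqrt ,
  λ c cf → FundamentalPeriod-cong (λ n → sym (trans (digits-agree cf n) (digits≗cfPattern n))) fundamentalPeriod
  where
  open Expansion a m s k a>0 m>0 s>0 k>0
  open SqrtExpansion.Certified D a₀ a₀²≤D D<[1+a₀]² numerators denominators digits refl refl step
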